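{- Let $A=(Q,q_0,F,I,T,X)$ be a timed automaton and let $\phi$ be a predicate on locations (with $F=\{q\mid\phi(q)\}$). Let $C$ be a finite set of triples $(q,Z,i)$ where $q\in Q$, $Z$ is a zone over $X$ (represented by a DBM in canonical form) and $i\in\mathbb{Z}$. Suppose that: (a) for every $(q,Z,i)\in C$, $Z\neq\emptyset$; (b) there exists $(q_0,Z_0,i)\in C$ with $\{\mathbf{0}\}\subseteq Z_0$; (c) for every $(q,Z,i)\in C$ and every $(q_1,Z_1)$ with $(q,Z)\Rightarrow(q_1,Z_1)$, there exists $(q_1,Z_1',j)\in C$ with $Z_1\subseteq Z_1'$, $i\ge j$, and ($\phi(q)$ implies $i>j$). Then the zone graph $\Rightarrow$ has no infinite path $(q_0,\{\mathbf{0}\}) = (p_0,W_0)\Rightarrow(p_1,W_1)\Rightarrow\cdots$ with $\phi(p_k)$ for infinitely many $k$. Consequently, the timed Büchi automaton $A$ is empty.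
   Context: A timed automaton $A=(Q,q_0,F,I,T,X)$ has a finite set of locations $Q$, initial location $q_0$, accepting locations $F\subseteq Q$, a finite set of clocks $X$, an invariant $I(q)$ for each location and a finite set $T$ of transitions $(q,g,R,q')$ with guard $g$ and reset set $R\subseteq X$; invariants and guards are conjunctions of constraints $x\,\#\,c$ with $x\in X$, $c\in\mathbb{N}$, $\#\in\{<,\le,=,\ge,>\}$. A clock valuation is a map $v:X\to\mathbb{R}_{\ge0}$; $\mathbf{0}$ is the all-zero valuation, assumed to satisfy $I(q_0)$. Steps: delay $(q,v)\to_\delta(q,v+\delta)$ for $\delta\ge0$ if $v+\delta$ satisfies $I(q)$; transition $(q,v)\to_t(q',v')$ for $t=(q,g,R,q')\in T$ if $v$ satisfies $g$, $v'$ equals $0$ on $R$ and $v$ elsewhere, and $v'$ satisfies $I(q')$. Write $(q,v)\to_{\delta,t}(q',v')$ if $(q,v)\to_\delta(q,v'')\to_t(q',v')$ for some $v''$. A run is an infinite sequence $(q_0,\mathbf{0})\to_{\delta_0,t_0}(q_1,v_1)\to_{\delta_1,t_1}\cdots$; it is non-Zeno if $\sum\delta_i$ is unbounded. The TBA $A$ is empty if it has no non-Zeno run visiting configurations with locations in $F$ infinitely often. A zone is a set of valuations defined by a conjunction of constraints $x\,\#\,c$ and $x-y\,\#\,c$ with $c\in\mathbb{Z}$. Zone graph: for nonempty sets of valuations $W,W'$, $(q,W)\Rightarrow^t(q',W')$ iff $W'$ is the set of all $v'$ such that $(q,v)\to_{\delta,t}(q',v')$ for some $v\in W$, $\delta\ge0$;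 $\Rightarrow=\bigcup_{t\in T}\Rightarrow^t$. -}

module Defs where

open import Data.Nat as ℕ using (ℕ; zero; suc)
open import Data.Integer as ℤ using (ℤ; +_; -[1+_])
open import Data.Fin using (Fin)
open import Data.Fin.Subset using (Subset; inside)
open import Data.Vec using (lookup)
open import Data.Bool using (true; false)
open import Data.Maybe using (Maybe; just; nothing)
open import Data.List using (List; []; _∷_)
open import Data.List.Membership.Propositional using (_∈_)
open import Data.List.Relation.Unary.All using (All)
open import Data.Product using (Σ; ∃; _×_; _,_)
open import Data.Unit using (⊤)
open import Relation.Nullary using (¬_)
open import Relation.Binary.PropositionalEquality using (_≡_; _≢_)
open import Relation.Binary.Structures using (IsTotalOrder)
open import Algebra.Structures using (IsCommutativeMonoid)

-- The paper uses ℝ≥0; the standard library has no reals,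
-- so we work over an arbitrary structure satisfying properties that
-- ℝ≥0 (with ι the inclusion ℕ → ℝ≥0) satisfies.  ℝ≥0 is an instance.

record TimeDomain : Set₁ where
  field
    D          : Set
    _≤_        : D → D → Set
    _+_        : D → D → D
    𝟘          : D
    ι          : ℕ → D
    isTotalOrder : IsTotalOrder _≡_ _≤_
    isCommMonoid : IsCommutativeMonoid _≡_ _+_ 𝟘
    𝟘-least    : ∀ x → 𝟘 ≤ x
    +-mono-≤   : ∀ {x y} z → x ≤ y → (x + z) ≤ (y + z)
    ι-zero     : ι 0 ≡ 𝟘
    ι-+        : ∀ m n → ι (m ℕ.+ n) ≡ (ι m + ι n)
    ι-pos      : ¬ (ι 1 ≤ 𝟘)

  _<_ : D → D → Set
  x < y = (x ≤ y) × (x ≢ y)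

data Cmp : Set where
  lt le eq ge gt : Cmp

module _ (𝕋 : TimeDomain) where
  open TimeDomain 𝕋

  cmp : Cmp → D → D → Set
  cmp lt a b = a < b
  cmp le a b = a ≤ b
  cmp eq a b = a ≡ b
  cmp ge a b = b ≤ a
  cmp gt a b = b < a

module _ (𝕋 : TimeDomain) (n : ℕ) where
  open TimeDomain 𝕋

  Val : Set
  Val = Fin n → D

  𝟎 : Val
  𝟎 x = 𝟘

  shift : Val → D → Val
  shift v δ x = v x + δ

  reset : Subset n → Val → Val
  reset R v x with lookup R x
  ... | true  = 𝟘
  ... | false = v x

  VSet : Set₁
  VSet = Val → Set

  _⊆_ : VSet → VSet → Set
  W ⊆ W' = ∀ v → W v → W' v

  _≐_ : VSet → VSet → Set
  W ≐ W' = (W ⊆ W') × (W' ⊆ W)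

  NonEmpty : VSet → Set
  NonEmpty W = ∃ λ v → W v

record ClockConstraint (n : ℕ) : Set where
  constructor clk
  field
    clock : Fin n
    op    : Cmp
    const : ℕ

Guard : ℕ → Set
Guard n = List (ClockConstraint n)

module _ (𝕋 : TimeDomain) {n : ℕ} where
  open TimeDomain 𝕋

  satCC : ClockConstraint n → Val 𝕋 n → Set
  satCC (clk x o c) v = cmp 𝕋 o (v x) (ι c)

  satG : Guard n → Val 𝕋 n → Set
  satG g v = All (λ cc → satCC cc v) g

-- A term is a clock or the constant 0 (nothing); the atomic constraint
-- (a , b , # , c) means  a - b # c.  With b = nothing this is  a # c,
-- with a = nothing it is  -b # c.  (This is exactly the information
-- carried by a DBM; canonical form of the DBM is irrelevant to the
-- set of valuations it denotes.)

record DiffConstraint (n : ℕ) : Set where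
  constructor dc
  field
    left  : Maybe (Fin n)
    right : Maybe (Fin n)
    op    : Cmp
    const : ℤ

Zone : ℕ → Set
Zone n = List (DiffConstraint n)

module _ (𝕋 : TimeDomain) {n : ℕ} where
  open TimeDomain 𝕋

  term : Maybe (Fin n) → Val 𝕋 n → D
  term (just x) v = v x
  term nothing  v = 𝟘

  -- a - b # c, written without subtraction:
  --   c = k ≥ 0 :     a # b + k
  --   c = -(k+1) :    a + (k+1) # b
  satDC : DiffConstraint n → Val 𝕋 n → Set
  satDC (dc a b o (+ k))      v = cmp 𝕋 o (term a v) (term b v + ι k)
  satDC (dc a b o -[1+ k ])   v = cmp 𝕋 o (term a v + ι (suc k)) (term b v)

  ⟦_⟧ : Zone n → VSet 𝕋 n
  ⟦ Z ⟧ v = All (λ c → satDC c v) Z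

-- Timed automata  A = (Q, q₀, F, I, T, X) with Q = Fin nQ, X = Fin nX.
-- Accepting locations F are given by the predicate φ in the theorem.

record Transition (nQ nX : ℕ) : Set where
  constructor tr
  field
    src   : Fin nQ
    guard : Guard nX
    resets : Subset nX
    tgt   : Fin nQ

record TA (nQ nX : ℕ) : Set where
  field
    q₀  : Fin nQ
    Inv : Fin nQ → Guard nX
    T   : List (Transition nQ nX)

module Semantics (𝕋 : TimeDomain) {nQ nX : ℕ} (A : TA nQ nX) where
  open TimeDomain 𝕋
  open TA A

  V : Set
  V = Val 𝕋 nX

  DelayStep : Fin nQ → V → D → V → Set
  DelayStep q v δ v'' = (v'' ≡ shift 𝕋 nX v δ) × satG 𝕋 (Inv q) v''

  TransStep : Fin nQ → V → Transition nQ nX → Fin nQ → V → Set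
  TransStep q v t q' v' =
    (t ∈ T) × (Transition.src t ≡ q) × (Transition.tgt t ≡ q') ×
    satG 𝕋 (Transition.guard t) v ×
    (∀ x → v' x ≡ reset 𝕋 nX (Transition.resets t) v x) ×
    satG 𝕋 (Inv q') v'

  Step : Fin nQ → V → D → Transition nQ nX → Fin nQ → V → Set
  Step q v δ t q' v' = ∃ λ v'' → DelayStep q v δ v'' × TransStep q v'' t q' v'

  psum : (ℕ → D) → ℕ → D
  psum δ zero    = 𝟘
  psum δ (suc k) = psum δ k + δ k

  record Run : Set where
    field
      loc   : ℕ → Fin nQ
      val   : ℕ → V
      delay : ℕ → D
      trans : ℕ → Transition nQ nX
      init-loc : loc 0 ≡ q₀
      init-val : ∀ x → val 0 x ≡ 𝟘
      step  : ∀ k → Step (loc k) (val k) (delay k) (trans k) (loc (suc k)) (val (suc k))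

  NonZeno : Run → Set
  NonZeno r = ∀ (b : D) → ∃ λ k → b < psum (Run.delay r) k

  InfOften : (ℕ → Set) → Set
  InfOften P = ∀ N → ∃ λ k → (N ℕ.≤ k) × P k

  TBAEmpty : (Fin nQ → Set) → Set
  TBAEmpty φ = ¬ (Σ Run λ r → NonZeno r × InfOften (λ k → φ (Run.loc r k)))

  ZStep : Transition nQ nX → Fin nQ → VSet 𝕋 nX → Fin nQ → VSet 𝕋 nX → Set
  ZStep t q W q' W' =
    NonEmpty 𝕋 nX W × NonEmpty 𝕋 nX W' ×
    _≐_ 𝕋 nX W' (λ v' → ∃ λ v → W v × ∃ λ δ → Step q v δ t q' v')

  _⇒_ : (Fin nQ × VSet 𝕋 nX) → (Fin nQ × VSet 𝕋 nX) → Set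
  (q , W) ⇒ (q' , W') = ∃ λ t → (t ∈ T) × ZStep t q W q' W'

  record AccZPath (φ : Fin nQ → Set) : Set₁ where
    field
      p    : ℕ → Fin nQ
      W    : ℕ → VSet 𝕋 nX
      init-loc : p 0 ≡ q₀
      init-set : _≐_ 𝕋 nX (W 0) (λ v → ∀ x → v x ≡ 𝟘)
      step : ∀ k → (p k , W k) ⇒ (p (suc k) , W (suc k))
      acc  : InfOften (λ k → φ (p k))

  Certificate : (Fin nQ → Set) → List (Fin nQ × Zone nX × ℤ) → Set₁
  Certificate φ C =
    (∀ {q Z i} → (q , Z , i) ∈ C → NonEmpty 𝕋 nX (⟦_⟧ 𝕋 Z)) ×
    (∃ λ Z₀ → ∃ λ i → ((q₀ , Z₀ , i) ∈ C) × _⊆_ 𝕋 nX (λ v → ∀ x → v x ≡ 𝟘) (⟦_⟧ 𝕋 Z₀)) ×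
    (∀ {q Z i} → (q , Z , i) ∈ C → ∀ q₁ (Z₁ : VSet 𝕋 nX) →
       (q , ⟦_⟧ 𝕋 Z) ⇒ (q₁ , Z₁) →
       ∃ λ Z₁' → ∃ λ j → ((q₁ , Z₁' , j) ∈ C) × _⊆_ 𝕋 nX Z₁ (⟦_⟧ 𝕋 Z₁') ×
         (j ℤ.≤ i) × (φ q → j ℤ.< i))

-- Along a zone-graph path (p₀,W₀) ⇒ (p₁,W₁) ⇒ ⋯ from (q₀,{𝟎}), hypothesis (c)
-- lets one choose triples (pₖ,Zₖ,iₖ) ∈ C with Wₖ ⊆ Zₖ step by step, because
-- post-images are monotone in the source set.  The ranks iₖ never increase and
-- strictly drop whenever φ(pₖ) holds; as they range over the finite set C they
-- are bounded below, so φ(pₖ) holds only finitely often.  Every run of A, Zeno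
-- or not, traces such a path (Wₖ = the valuations reachable along its first k
-- steps), so A has no accepting run at all.
module Submission where

open import Defs
open import Data.Nat using (ℕ)
open import Data.Integer using (ℤ)
open import Data.Fin using (Fin)
open import Data.List using (List)
open import Data.Product using (_×_)
open import Relation.Nullary using (¬_)

open import Data.Nat as ℕ using (zero; suc; _≤′_; ≤′-refl; ≤′-step)
import Data.Nat.Properties as ℕ
open import Data.Integer as ℤ using (+_; _-_; -_; ∣_∣; _⊓_)
import Data.Integer.Properties as ℤ
open import Data.List using ([]; _∷_)
open import Data.List.Membership.Propositional using (_∈_)
open import Data.List.Relation.Unary.Any using (here; there)
open import Data.Product using (Σ; ∃; _,_; proj₁; proj₂)
open import Data.Empty using (⊥)
open import Relation.Binary.PropositionalEquality using (_≡_; refl; sym; subst; subst₂)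

antitone-≤′ : {g : ℕ → ℕ} → (∀ k → g (suc k) ℕ.≤ g k) →
              ∀ {k k′} → k ≤′ k′ → g k′ ℕ.≤ g k
antitone-≤′ step ≤′-refl        = ℕ.≤-refl
antitone-≤′ step (≤′-step k≤′k′) = ℕ.≤-trans (step _) (antitone-≤′ step k≤′k′)

no-infinite-descent : (g : ℕ → ℕ) → (∀ k → g (suc k) ℕ.≤ g k) →
                      (∀ N → ∃ λ k → N ℕ.≤ k × g (suc k) ℕ.< g k) → ⊥
no-infinite-descent g step drops = bounded-by (suc (g 0)) 0 ℕ.≤-refl
  where
  bounded-by : ∀ n k → g k ℕ.< n → ⊥
  bounded-by (suc n) k (ℕ.s≤s gₖ≤n) with drops k
  ... | k′ , k≤k′ , drop =
    bounded-by n (suc k′)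
      (ℕ.<-≤-trans drop (ℕ.≤-trans (antitone-≤′ step (ℕ.≤⇒≤′ k≤k′)) gₖ≤n))

module _ {b : ℤ} where

  distance-from-lowerBound : ∀ {i} → b ℤ.≤ i → + ∣ i - b ∣ ≡ i - b
  distance-from-lowerBound b≤i = ℤ.0≤i⇒+∣i∣≡i (ℤ.i≤j⇒0≤j-i b≤i)

  distance-mono-≤ : ∀ {i j} → b ℤ.≤ i → b ℤ.≤ j → i ℤ.≤ j → ∣ i - b ∣ ℕ.≤ ∣ j - b ∣
  distance-mono-≤ b≤i b≤j i≤j = ℤ.drop‿+≤+
    (subst₂ ℤ._≤_ (sym (distance-from-lowerBound b≤i)) (sym (distance-from-lowerBound b≤j))
      (ℤ.+-monoˡ-≤ (- b) i≤j))

  distance-mono-< : ∀ {i j} → b ℤ.≤ i → b ℤ.≤ j → i ℤ.< j → ∣ i - b ∣ ℕ.< ∣ j - b ∣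
  distance-mono-< b≤i b≤j i<j = ℤ.drop‿+<+
    (subst₂ ℤ._<_ (sym (distance-from-lowerBound b≤i)) (sym (distance-from-lowerBound b≤j))
      (ℤ.+-monoˡ-< (- b) i<j))

no-infinite-descent-ℤ : (c : ℕ → ℤ) (b : ℤ) → (∀ k → b ℤ.≤ c k) →
                        (∀ k → c (suc k) ℤ.≤ c k) →
                        (∀ N → ∃ λ k → N ℕ.≤ k × c (suc k) ℤ.< c k) → ⊥
no-infinite-descent-ℤ c b b≤c step drops =
  no-infinite-descent (λ k → ∣ c k - b ∣)
    (λ k → distance-mono-≤ (b≤c (suc k)) (b≤c k) (step k))
    λ N → let k , N≤k , drop = drops N in
          k , N≤k , distance-mono-< (b≤c (suc k)) (b≤c k) drop

finite-lowerBound : {A : Set} (f : A → ℤ) (xs : List A) →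
                    ∃ λ b → ∀ {x} → x ∈ xs → b ℤ.≤ f x
finite-lowerBound f []       = ℤ.0ℤ , λ ()
finite-lowerBound f (x ∷ xs) with finite-lowerBound f xs
... | b , b≤ = f x ⊓ b , λ where
  (here refl)   → ℤ.i⊓j≤i (f x) b
  (there x∈xs) → ℤ.i≤j⇒k⊓i≤j (f x) (b≤ x∈xs)

module _ (𝕋 : TimeDomain) {nQ nX : ℕ} (A : TA nQ nX) where
  open Semantics 𝕋 A
  open TA A

  Post : Fin nQ → VSet 𝕋 nX → Transition nQ nX → Fin nQ → VSet 𝕋 nX
  Post q W t q′ v′ = ∃ λ v → W v × ∃ λ δ → Step q v δ t q′ v′

  Post-mono : ∀ {q W W′ t q′} → _⊆_ 𝕋 nX W W′ →
              _⊆_ 𝕋 nX (Post q W t q′) (Post q W′ t q′)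
  Post-mono W⊆W′ v′ (v , v∈W , δ , step) = v , W⊆W′ v v∈W , δ , step

  ≐-refl : ∀ {W} → _≐_ 𝕋 nX W W
  ≐-refl = (λ _ v∈W → v∈W) , (λ _ v∈W → v∈W)

  ⇒-Post : ∀ {q W t q′} → t ∈ T → NonEmpty 𝕋 nX W → NonEmpty 𝕋 nX (Post q W t q′) →
           (q , W) ⇒ (q′ , Post q W t q′)
  ⇒-Post t∈T W≠∅ Post≠∅ = _ , t∈T , W≠∅ , Post≠∅ , ≐-refl

  record Cover (C : List (Fin nQ × Zone nX × ℤ)) (q : Fin nQ) (W : VSet 𝕋 nX) : Set where
    field
      zone   : Zone nX
      rank   : ℤ
      member : (q , zone , rank) ∈ C
      covers : _⊆_ 𝕋 nX W (⟦_⟧ 𝕋 zone)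

  open Cover

  ⇒-mono : ∀ {q W S q′ W′} → _⊆_ 𝕋 nX W S → NonEmpty 𝕋 nX S →
           (q , W) ⇒ (q′ , W′) → ∃ λ S′ → ((q , S) ⇒ (q′ , S′)) × _⊆_ 𝕋 nX W′ S′
  ⇒-mono {q} {W} {S} {q′} {W′} W⊆S S≠∅ (t , t∈T , _ , (v′ , v′∈W′) , W′⊆Post , _) =
    _ , ⇒-Post t∈T S≠∅ (v′ , W′⊆PostS v′ v′∈W′) , W′⊆PostS
    where
    W′⊆PostS : _⊆_ 𝕋 nX W′ (Post q S t q′)
    W′⊆PostS = λ v v∈W′ → Post-mono W⊆S v (W′⊆Post v v∈W′)

  Cover-step : ∀ {φ C q W q′ W′} → Certificate φ C → (c : Cover C q W) →
               (q , W) ⇒ (q′ , W′) →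
               Σ (Cover C q′ W′) λ c′ → rank c′ ℤ.≤ rank c × (φ q → rank c′ ℤ.< rank c)
  Cover-step {q′ = q′} (nonempty , _ , progress) c W⇒W′
    with ⇒-mono (covers c) (nonempty (member c)) W⇒W′
  ... | S′ , Z⇒S′ , W′⊆S′ with progress (member c) q′ S′ Z⇒S′
  ... | Z′ , j , Z′∈C , S′⊆Z′ , j≤i , φ⇒j<i =
    record { zone = Z′ ; rank = j ; member = Z′∈C
           ; covers = λ v v∈W′ → S′⊆Z′ v (W′⊆S′ v v∈W′) } ,
    j≤i , φ⇒j<i

  certificate⇒¬AccZPath : ∀ {φ C} → Certificate φ C → ¬ AccZPath φ
  certificate⇒¬AccZPath {φ} {C} cert@(_ , (Z₀ , i₀ , Z₀∈C , 𝟎∈Z₀) , _) path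
    with finite-lowerBound (λ (_ , _ , i) → i) C
  ... | b , b≤ =
    no-infinite-descent-ℤ (λ k → rank (cover k)) b (λ k → b≤ (member (cover k)))
      (λ k → proj₁ (proj₂ (next k)))
      (λ N → let k , N≤k , φpₖ = acc N in k , N≤k , proj₂ (proj₂ (next k)) φpₖ)
    where
    open AccZPath path
    cover : ∀ k → Cover C (p k) (W k)
    next : ∀ k → Σ (Cover C (p (suc k)) (W (suc k))) λ c′ →
                 rank c′ ℤ.≤ rank (cover k) × (φ (p k) → rank c′ ℤ.< rank (cover k))
    cover zero    = subst (λ q → Cover C q (W 0)) (sym init-loc)
      record { zone = Z₀ ; rank = i₀ ; member = Z₀∈C
             ; covers = λ v v∈W₀ → 𝟎∈Z₀ v (proj₁ init-set v v∈W₀) }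
    cover (suc k) = proj₁ (next k)
    next k = Cover-step cert (cover k) (step k)

  module _ (r : Run) where
    open Run r

    Reach : ℕ → VSet 𝕋 nX
    Reach zero    v = ∀ x → v x ≡ TimeDomain.𝟘 𝕋
    Reach (suc k) = Post (loc k) (Reach k) (trans k) (loc (suc k))

    val∈Reach : ∀ k → Reach k (val k)
    val∈Reach zero    = init-val
    val∈Reach (suc k) = val k , val∈Reach k , delay k , step k

    trans∈T : ∀ k → trans k ∈ T
    trans∈T k = let _ , _ , t∈T , _ = step k in t∈T

    run⇒AccZPath : ∀ {φ} → InfOften (λ k → φ (loc k)) → AccZPath φ
    run⇒AccZPath φ-inf = record
      { p        = loc
      ; W        = Reach
      ; init-loc = init-loc
      ; init-set = ≐-refl
      ; step     = λ k → ⇒-Post (trans∈T k) (val k , val∈Reach k)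
                                 (val (suc k) , val∈Reach (suc k))
      ; acc      = φ-inf
      }

  ¬AccZPath⇒TBAEmpty : ∀ {φ} → ¬ AccZPath φ → TBAEmpty φ
  ¬AccZPath⇒TBAEmpty ¬path (r , _ , φ-inf) = ¬path (run⇒AccZPath r φ-inf)

-- That 𝟎 satisfies I(q₀) only matters for runs to exist; the argument does not use it.
theorem4 : (𝕋 : TimeDomain) {nQ nX : ℕ} (A : TA nQ nX) →
           let open Semantics 𝕋 A in
           satG 𝕋 (TA.Inv A (TA.q₀ A)) (𝟎 𝕋 nX) →
           (φ : Fin nQ → Set) (C : List (Fin nQ × Zone nX × ℤ)) →
           Certificate φ C →
           ¬ AccZPath φ × TBAEmpty φ
theorem4 𝕋 A _ φ C cert = ¬path , ¬AccZPath⇒TBAEmpty 𝕋 A ¬path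
  where
  ¬path : ¬ Semantics.AccZPath 𝕋 A φ
  ¬path = certificate⇒¬AccZPath 𝕋 A cert
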